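{- $\textsc{Three-valued Ccv}$ and $\textsc{Ccv}$ are equivalent under $\mathsf{AC}^0$ many-one reductions.
   Context: $\textsc{Ccv}$: given a comparator circuit (wires and a sequence of comparator gates, each mapping the values $(p,q)$ of two wires to $(p\wedge q,p\vee q)$), a Boolean input value for each wire and a designated wire, decide whether that wire outputs $1$. $\textsc{Three-valued Ccv}$ is the same problem except that wires take values in $\{0,1,\ast\}$ and comparator gates use three-valued operations: $p\wedge q=0$ if $p=0$ or $q=0$, $=1$ if $p=q=1$, and $=\ast$ otherwise; $p\vee q=0$ if $p=q=0$, $=1$ if $p=1$ or $q=1$, and $=\ast$ otherwise. $A$ is $\mathsf{AC}^0$ many-one reducible to $B$ if there is a uniform $\mathsf{AC}^0$ computable function $F$ with $A(X)\leftrightarrow B(F(X))$. -}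

module Defs where

open import Data.Nat using (ℕ; zero; suc; _+_; _*_; _≤_; _<_; _≤ᵇ_; _<ᵇ_; _≡ᵇ_)
open import Data.Bool using (Bool; true; false; _∧_; _∨_; not; if_then_else_)
open import Data.List using (List; []; _∷_; [_]; length; upTo)
open import Data.Maybe using (Maybe; just; nothing; _>>=_)
open import Data.Product using (_×_; _,_; proj₁; proj₂; ∃)
open import Relation.Binary.PropositionalEquality using (_≡_)
open import Function.Bundles using (_⇔_)

BitString : Set
BitString = List Bool

-- i-th bit (false beyond the end)
bitAt : BitString → ℕ → Bool
bitAt []       _       = false
bitAt (b ∷ _)  zero    = b
bitAt (_ ∷ bs) (suc n) = bitAt bs n

allB : {A : Set} → (A → Bool) → List A → Bool
allB p []       = true
allB p (x ∷ xs) = p x ∧ allB p xs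

anyB : {A : Set} → (A → Bool) → List A → Bool
anyB p []       = false
anyB p (x ∷ xs) = p x ∨ anyB p xs

-- Uniform AC⁰ = FO[+,×] (Barrington–Immerman–Straubing).

data Term : Set where
  var       : ℕ → Term
  zer one   : Term
  len       : Term
  _⊕_ _⊗_   : Term → Term → Term

data Form : Set where
  bit       : Term → Form
  _≤f_ _≡f_ : Term → Term → Form
  ¬f        : Form → Form
  _∧f_ _∨f_ : Form → Form → Form
  ∀≤ ∃≤     : Term → Form → Form   -- ∀ x ≤ t . φ  /  ∃ x ≤ t . φ  (x = var 0 in φ)

Env : Set
Env = ℕ → ℕ

push : ℕ → Env → Env
push x ρ zero    = x
push x ρ (suc n) = ρ n

env₀ : Env
env₀ _ = 0

evalT : BitString → Env → Term → ℕ
evalT X ρ (var n) = ρ n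
evalT X ρ zer     = 0
evalT X ρ one     = 1
evalT X ρ len     = length X
evalT X ρ (s ⊕ t) = evalT X ρ s + evalT X ρ t
evalT X ρ (s ⊗ t) = evalT X ρ s * evalT X ρ t

evalF : BitString → Env → Form → Bool
evalF X ρ (bit t)   = bitAt X (evalT X ρ t)
evalF X ρ (s ≤f t)  = evalT X ρ s ≤ᵇ evalT X ρ t
evalF X ρ (s ≡f t)  = evalT X ρ s ≡ᵇ evalT X ρ t
evalF X ρ (¬f φ)    = not (evalF X ρ φ)
evalF X ρ (φ ∧f ψ)  = evalF X ρ φ ∧ evalF X ρ ψ
evalF X ρ (φ ∨f ψ)  = evalF X ρ φ ∨ evalF X ρ ψ
evalF X ρ (∀≤ t φ)  = allB (λ x → evalF X (push x ρ) φ) (upTo (suc (evalT X ρ t)))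
evalF X ρ (∃≤ t φ)  = anyB (λ x → evalF X (push x ρ) φ) (upTo (suc (evalT X ρ t)))

-- F is uniform AC⁰ computable: its output length is bounded by a term
-- (polynomial) in |X|, and both the length graph  i < |F(X)|  and the
-- bit graph  F(X)(i)  are FO[+,×]-definable (free variable i = var 0).
record AC0Function (F : BitString → BitString) : Set where
  field
    bound    : Term
    lenForm  : Form
    bitForm  : Form
    bound-ok : ∀ X → length (F X) ≤ evalT X env₀ bound
    len-ok   : ∀ X i → evalF X (push i env₀) lenForm ≡ (i <ᵇ length (F X))
    bit-ok   : ∀ X i → i < length (F X) → evalF X (push i env₀) bitForm ≡ bitAt (F X) i

_≤AC0_ : (BitString → Set) → (BitString → Set) → Set
A ≤AC0 B = ∃ λ (F : BitString → BitString) → AC0Function F × (∀ X → A X ⇔ B (F X))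

data T3 : Set where
  t0 t1 t* : T3

_⊓₃_ : T3 → T3 → T3
t0 ⊓₃ _  = t0
_  ⊓₃ t0 = t0
t1 ⊓₃ t1 = t1
_  ⊓₃ _  = t*

_⊔₃_ : T3 → T3 → T3
t1 ⊔₃ _  = t1
_  ⊔₃ t1 = t1
t0 ⊔₃ t0 = t0
_  ⊔₃ _  = t*

record Circuit (V : Set) : Set where
  constructor circuit
  field
    inputs : List V              -- one input value per wire; #wires = length inputs
    out    : ℕ
    gates  : List (ℕ × ℕ)        -- gate (a , b): wire a ← p ∧ q, wire b ← p ∨ q

getAt : {V : Set} → V → List V → ℕ → V
getAt d []       _       = d
getAt d (x ∷ _)  zero    = x
getAt d (_ ∷ xs) (suc n) = getAt d xs n

setAt : {V : Set} → List V → ℕ → V → List V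
setAt []       _       v = []
setAt (_ ∷ xs) zero    v = v ∷ xs
setAt (x ∷ xs) (suc n) v = x ∷ setAt xs n v

runGates : {V : Set} → V → (V → V → V) → (V → V → V) → List V → List (ℕ × ℕ) → List V
runGates d _&_ _∣_ s [] = s
runGates d _&_ _∣_ s ((a , b) ∷ gs) =
  let p = getAt d s a
      q = getAt d s b
  in runGates d _&_ _∣_ (setAt (setAt s a (p & q)) b (p ∣ q)) gs

evalCircuit : {V : Set} → V → (V → V → V) → (V → V → V) → Circuit V → V
evalCircuit d _&_ _∣_ (circuit ins o gs) = getAt d (runGates d _&_ _∣_ ins gs) o

-- Each symbol takes 2 bits: 00 = '0', 01 = '1', 10 = '#', 11 = '*'.
-- An instance is   w # d # a₁ # b₁ # … # aₖ # bₖ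
-- where w is the word of input values (one symbol per wire), d is the
-- designated wire and (aᵢ , bᵢ) the i-th gate, all wire numbers written
-- in binary (MSB first, nonempty).

data Sym : Set where
  s0 s1 sH sS : Sym

toSyms : BitString → Maybe (List Sym)
toSyms []                 = just []
toSyms (_ ∷ [])           = nothing
toSyms (x ∷ y ∷ bs) with toSyms bs
... | nothing = nothing
... | just ss = just (sym x y ∷ ss)
  where
  sym : Bool → Bool → Sym
  sym false false = s0
  sym false true  = s1
  sym true  false = sH
  sym true  true  = sS

consHead : Sym → List (List Sym) → List (List Sym)
consHead x []       = [ [ x ] ]
consHead x (f ∷ fs) = (x ∷ f) ∷ fs

splitH : List Sym → List (List Sym)
splitH []        = [ [] ]
splitH (sH ∷ xs) = [] ∷ splitH xs
splitH (x ∷ xs)  = consHead x (splitH xs)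

binAcc : ℕ → List Sym → Maybe ℕ
binAcc acc []        = just acc
binAcc acc (s0 ∷ xs) = binAcc (2 * acc) xs
binAcc acc (s1 ∷ xs) = binAcc (suc (2 * acc)) xs
binAcc acc (_ ∷ _)   = nothing

binVal : List Sym → Maybe ℕ
binVal [] = nothing
binVal xs = binAcc 0 xs

parseGates : List (List Sym) → Maybe (List (ℕ × ℕ))
parseGates []            = just []
parseGates (_ ∷ [])      = nothing
parseGates (a ∷ b ∷ fs)  =
  binVal a >>= λ x → binVal b >>= λ y → parseGates fs >>= λ gs → just ((x , y) ∷ gs)

mapM : {V : Set} → (Sym → Maybe V) → List Sym → Maybe (List V)
mapM f []       = just []
mapM f (x ∷ xs) = f x >>= λ v → mapM f xs >>= λ vs → just (v ∷ vs)

wellFormed : {V : Set} → Circuit V → Bool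
wellFormed (circuit ins o gs) =
  (o <ᵇ length ins) ∧ allB (λ g → (proj₁ g <ᵇ length ins) ∧ (proj₂ g <ᵇ length ins)) gs

decode : {V : Set} → (Sym → Maybe V) → BitString → Maybe (Circuit V)
decode val X with toSyms X
... | nothing = nothing
... | just ss with splitH ss
...   | (w ∷ d ∷ fs) =
          mapM val w >>= λ ins →
          binVal d >>= λ o →
          parseGates fs >>= λ gs →
          if wellFormed (circuit ins o gs) then just (circuit ins o gs) else nothing
...   | _ = nothing

boolVal : Sym → Maybe Bool
boolVal s0 = just false
boolVal s1 = just true
boolVal _  = nothing

t3Val : Sym → Maybe T3
t3Val s0 = just t0
t3Val s1 = just t1
t3Val sS = just t*
t3Val sH = nothing

CCV : BitString → Set
CCV X = ∃ λ C → decode boolVal X ≡ just C × evalCircuit false _∧_ _∨_ C ≡ true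

ThreeValuedCCV : BitString → Set
ThreeValuedCCV X = ∃ λ C → decode t3Val X ≡ just C × evalCircuit t0 _⊓₃_ _⊔₃_ C ≡ t1

-- Comparator gates compute min and max, on the chain 0 < 1 for Ccv and on 0 < * < 1 for the
-- three-valued problem.  Hence threshold (1 ↦ 1, and 0, * ↦ 0) and embed (the inclusion) are
-- lattice homomorphisms: they commute with circuit evaluation, and they preserve and reflect the
-- output value 1.  So both reductions merely translate encodings symbol by symbol, '*' ↦ '0' in
-- one direction and the identity in the other, which first-order formulas do bitwise.  The
-- translation must not turn non-instances into instances: a '*' after the first separator (inside
-- a wire number) invalidates a three-valued encoding, and any '*' invalidates a Boolean one.  A
-- first-order sentence detects such strings, and they are sent to the empty string, which
-- encodes nothing.

module Submission where

open import Defs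
open import Data.Bool using (Bool; true; false; _∧_; _∨_; not; if_then_else_)
open import Data.Bool.Properties using (∨-identityʳ; ∨-assoc; ∨-conicalˡ; ∨-conicalʳ; ∧-identityʳ; ∧-zeroʳ)
open import Data.List using (List; []; _∷_; length; map; drop; upTo; applyUpTo)
open import Data.List.Properties using (length-map; length-applyUpTo; map-id; map-id-local)
open import Data.List.Relation.Unary.All as All using (All; []; _∷_)
open import Data.Maybe using (Maybe; just; nothing; _>>=_) renaming (map to mmap)
open import Data.Nat using (ℕ; zero; suc; _+_; _≤_; _<_; _≡ᵇ_; _<ᵇ_; _≤ᵇ_; z≤n; s≤s; ⌊_/2⌋)
open import Data.Nat.Properties using (≤-reflexive; +-suc; m≤n⇒m≤1+n; ⌊n/2⌋≤n; suc-injective)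
open import Data.Product using (_×_; _,_; proj₁; proj₂; ∃)
open import Function using (_∘_; id)
open import Function.Bundles using (_⇔_; mk⇔; Equivalence)
open import Relation.Binary.PropositionalEquality using (_≡_; refl; sym; trans; cong; cong₂; subst; module ≡-Reasoning)

open ≡-Reasoning

anyB-cong : ∀ {A : Set} {p q : A → Bool} → (∀ x → p x ≡ q x) → ∀ xs → anyB p xs ≡ anyB q xs
anyB-cong p≗q []       = refl
anyB-cong p≗q (x ∷ xs) = cong₂ _∨_ (p≗q x) (anyB-cong p≗q xs)

anyB-false : ∀ {A : Set} {p : A → Bool} → (∀ x → p x ≡ false) → ∀ xs → anyB p xs ≡ false
anyB-false p≡false xs = trans (anyB-cong p≡false xs) (none xs)
  where
  none : ∀ xs → anyB (λ _ → false) xs ≡ false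
  none []       = refl
  none (_ ∷ xs) = none xs

anyB≡false⇒All : ∀ {A : Set} {p : A → Bool} xs → anyB p xs ≡ false → All (λ x → p x ≡ false) xs
anyB≡false⇒All []       _    = []
anyB≡false⇒All (x ∷ xs) none = ∨-conicalˡ _ _ none ∷ anyB≡false⇒All xs (∨-conicalʳ _ _ none)

anyB-applyUpTo : ∀ (p : ℕ → Bool) f m → anyB p (applyUpTo f m) ≡ anyB (p ∘ f) (upTo m)
anyB-applyUpTo p f zero    = refl
anyB-applyUpTo p f (suc m) =
  cong (p (f 0) ∨_) (trans (anyB-applyUpTo p (f ∘ suc) m) (sym (anyB-applyUpTo (p ∘ f) suc m)))

anyB-upTo-suc : ∀ (p : ℕ → Bool) m → anyB p (upTo (suc m)) ≡ p 0 ∨ anyB (p ∘ suc) (upTo m)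
anyB-upTo-suc p m = cong (p 0 ∨_) (anyB-applyUpTo p suc m)

anyB-getAt-upTo : ∀ {A : Set} (p : A → Bool) {d} → p d ≡ false →
                  ∀ xs m → length xs ≤ m → anyB (λ n → p (getAt d xs n)) (upTo m) ≡ anyB p xs
anyB-getAt-upTo p pd≡false []       m       _         = anyB-false (λ _ → pd≡false) (upTo m)
anyB-getAt-upTo p pd≡false (x ∷ xs) (suc m) (s≤s |xs|≤m) =
  trans (anyB-upTo-suc _ m) (cong (p x ∨_) (anyB-getAt-upTo p pd≡false xs m |xs|≤m))

anyB-≡ᵇ-upTo : ∀ (p : ℕ → Bool) k m → k < m → anyB (λ n → (n ≡ᵇ k) ∧ p n) (upTo m) ≡ p k
anyB-≡ᵇ-upTo p zero    (suc m) _ =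
  trans (anyB-upTo-suc _ m) (trans (cong (p 0 ∨_) (anyB-false (λ _ → refl) (upTo m))) (∨-identityʳ (p 0)))
anyB-≡ᵇ-upTo p (suc k) (suc m) (s≤s k<m) =
  trans (anyB-upTo-suc (λ n → (n ≡ᵇ suc k) ∧ p n) m) (anyB-≡ᵇ-upTo (p ∘ suc) k m k<m)

mapCircuit : {A B : Set} → (A → B) → Circuit A → Circuit B
mapCircuit h (circuit ins o gs) = circuit (map h ins) o gs

getAt-map : ∀ {A B : Set} (h : A → B) {dA dB} → h dA ≡ dB → ∀ s n → getAt dB (map h s) n ≡ h (getAt dA s n)
getAt-map h h-d []      n       = sym h-d
getAt-map h h-d (x ∷ s) zero    = refl
getAt-map h h-d (x ∷ s) (suc n) = getAt-map h h-d s n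

setAt-map : ∀ {A B : Set} (h : A → B) s n v → setAt (map h s) n (h v) ≡ map h (setAt s n v)
setAt-map h []      n       v = refl
setAt-map h (x ∷ s) zero    v = refl
setAt-map h (x ∷ s) (suc n) v = cong (h x ∷_) (setAt-map h s n v)

module _ {A B : Set} (h : A → B) {dA : A} {dB : B} {_&A_ _∣A_ : A → A → A} {_&B_ _∣B_ : B → B → B}
         (h-d : h dA ≡ dB) (h-& : ∀ p q → h (p &A q) ≡ h p &B h q)
         (h-∣ : ∀ p q → h (p ∣A q) ≡ h p ∣B h q) where

  runGates-map : ∀ s gs → runGates dB _&B_ _∣B_ (map h s) gs ≡ map h (runGates dA _&A_ _∣A_ s gs)
  runGates-map s []             = refl
  runGates-map s ((a , b) ∷ gs) = trans (cong (λ s′ → runGates dB _&B_ _∣B_ s′ gs) gate-map) (runGates-map _ gs)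
    where
    p q : A
    p = getAt dA s a
    q = getAt dA s b
    gate-map : setAt (setAt (map h s) a (getAt dB (map h s) a &B getAt dB (map h s) b)) b
                     (getAt dB (map h s) a ∣B getAt dB (map h s) b)
             ≡ map h (setAt (setAt s a (p &A q)) b (p ∣A q))
    gate-map rewrite getAt-map h h-d s a | getAt-map h h-d s b | sym (h-& p q) | sym (h-∣ p q)
                   | setAt-map h s a (p &A q) | setAt-map h (setAt s a (p &A q)) b (p ∣A q) = refl

  evalCircuit-map : ∀ C → evalCircuit dB _&B_ _∣B_ (mapCircuit h C) ≡ h (evalCircuit dA _&A_ _∣A_ C)
  evalCircuit-map (circuit ins o gs) =
    trans (cong (λ s → getAt dB s o) (runGates-map ins gs)) (getAt-map h h-d (runGates dA _&A_ _∣A_ ins gs) o)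

threshold : T3 → Bool
threshold t1 = true
threshold _  = false

embed : Bool → T3
embed true  = t1
embed false = t0

threshold-⊓₃ : ∀ p q → threshold (p ⊓₃ q) ≡ threshold p ∧ threshold q
threshold-⊓₃ t0 q  = refl
threshold-⊓₃ t1 t0 = refl
threshold-⊓₃ t1 t1 = refl
threshold-⊓₃ t1 t* = refl
threshold-⊓₃ t* t0 = refl
threshold-⊓₃ t* t1 = refl
threshold-⊓₃ t* t* = refl

threshold-⊔₃ : ∀ p q → threshold (p ⊔₃ q) ≡ threshold p ∨ threshold q
threshold-⊔₃ t1 q  = refl
threshold-⊔₃ t0 t0 = refl
threshold-⊔₃ t0 t1 = refl
threshold-⊔₃ t0 t* = refl
threshold-⊔₃ t* t0 = refl
threshold-⊔₃ t* t1 = refl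
threshold-⊔₃ t* t* = refl

embed-∧ : ∀ p q → embed (p ∧ q) ≡ embed p ⊓₃ embed q
embed-∧ false q     = refl
embed-∧ true  false = refl
embed-∧ true  true  = refl

embed-∨ : ∀ p q → embed (p ∨ q) ≡ embed p ⊔₃ embed q
embed-∨ true  q     = refl
embed-∨ false false = refl
embed-∨ false true  = refl

threshold≡true⇔ : ∀ v → threshold v ≡ true ⇔ v ≡ t1
threshold≡true⇔ v = mk⇔ (to v) λ { refl → refl }
  where
  to : ∀ v → threshold v ≡ true → v ≡ t1
  to t1 _ = refl

embed≡t1⇔ : ∀ b → embed b ≡ t1 ⇔ b ≡ true
embed≡t1⇔ b = mk⇔ (to b) λ { refl → refl }
  where
  to : ∀ b → embed b ≡ t1 → b ≡ true
  to true _ = refl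

Accepts : {V : Set} → (Sym → Maybe V) → (Circuit V → V) → V → BitString → Set
Accepts val eval a X = ∃ λ C → decode val X ≡ just C × eval C ≡ a

homomorphism⇒≤AC0 : ∀ {A B : Set} {valA : Sym → Maybe A} {valB : Sym → Maybe B}
                      {evalA : Circuit A → A} {evalB : Circuit B → B} {a : A} {b : B} (h : A → B) →
                    (∀ C → evalB (mapCircuit h C) ≡ h (evalA C)) → (∀ v → h v ≡ b ⇔ v ≡ a) →
                    ∀ F → AC0Function F → (∀ X → decode valB (F X) ≡ mmap (mapCircuit h) (decode valA X)) →
                    Accepts valA evalA a ≤AC0 Accepts valB evalB b
homomorphism⇒≤AC0 {valA = valA} {valB} {evalA} {evalB} {a} {b} h eval-map h≡b⇔ F F-AC0 decode-map =
  F , F-AC0 , λ X → mk⇔ (forth X) (back X)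
  where
  open Equivalence
  forth : ∀ X → Accepts valA evalA a X → Accepts valB evalB b (F X)
  forth X (C , decodes , accepts) =
    mapCircuit h C , trans (decode-map X) (cong (mmap (mapCircuit h)) decodes) ,
    trans (eval-map C) (from (h≡b⇔ _) accepts)
  back : ∀ X → Accepts valB evalB b (F X) → Accepts valA evalA a X
  back X (C′ , decodes′ , accepts′) with decode valA X | trans (sym (decode-map X)) decodes′
  ... | just C | refl = C , refl , to (h≡b⇔ _) (trans (sym (eval-map C)) accepts′)

hi lo : Sym → Bool
hi s0 = false
hi s1 = false
hi sH = true
hi sS = true
lo s0 = false
lo s1 = true
lo sH = false
lo sS = true

isStar isHash : Sym → Bool
isStar s = hi s ∧ lo s
isHash s = hi s ∧ not (lo s)

encode : List Sym → BitString
encode []       = []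
encode (s ∷ ss) = hi s ∷ lo s ∷ encode ss

encode-bits : ∀ ss n → bitAt (encode ss) (n + n) ≡ hi (getAt s0 ss n)
                      × bitAt (encode ss) (suc (n + n)) ≡ lo (getAt s0 ss n)
encode-bits []       n       = refl , refl
encode-bits (s ∷ ss) zero    = refl , refl
encode-bits (s ∷ ss) (suc n) rewrite +-suc n n = encode-bits ss n

encode-isStar : ∀ ss n → bitAt (encode ss) (n + n) ∧ bitAt (encode ss) (suc (n + n)) ≡ isStar (getAt s0 ss n)
encode-isStar ss n = let (hi≡ , lo≡) = encode-bits ss n in cong₂ _∧_ hi≡ lo≡

encode-isHash : ∀ ss n → bitAt (encode ss) (n + n) ∧ not (bitAt (encode ss) (suc (n + n))) ≡ isHash (getAt s0 ss n)
encode-isHash ss n = let (hi≡ , lo≡) = encode-bits ss n in cong₂ _∧_ hi≡ (cong not lo≡)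

length-encode : ∀ ss → length ss ≤ length (encode ss)
length-encode []       = z≤n
length-encode (s ∷ ss) = s≤s (m≤n⇒m≤1+n (length-encode ss))

length-encode-map : ∀ (k : Sym → Sym) ss → length (encode (map k ss)) ≡ length (encode ss)
length-encode-map k []       = refl
length-encode-map k (s ∷ ss) = cong (suc ∘ suc) (length-encode-map k ss)

toSyms-encode : ∀ ss → toSyms (encode ss) ≡ just ss
toSyms-encode []        = refl
toSyms-encode (s0 ∷ ss) rewrite toSyms-encode ss = refl
toSyms-encode (s1 ∷ ss) rewrite toSyms-encode ss = refl
toSyms-encode (sH ∷ ss) rewrite toSyms-encode ss = refl
toSyms-encode (sS ∷ ss) rewrite toSyms-encode ss = refl

Undecodable : BitString → Set
Undecodable X = ∀ Y → length Y ≡ length X → toSyms Y ≡ nothing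

data Parity : BitString → Set where
  encoded : ∀ ss → Parity (encode ss)
  odd     : ∀ {X} → Undecodable X → Parity X

parity : ∀ X → Parity X
parity []           = encoded []
parity (x ∷ [])     = odd λ { (_ ∷ []) _ → refl }
parity (x ∷ y ∷ X) with parity X
... | encoded ss = encoded-∷ x y
  where
  encoded-∷ : ∀ x y → Parity (x ∷ y ∷ encode ss)
  encoded-∷ false false = encoded (s0 ∷ ss)
  encoded-∷ false true  = encoded (s1 ∷ ss)
  encoded-∷ true  false = encoded (sH ∷ ss)
  encoded-∷ true  true  = encoded (sS ∷ ss)
... | odd undecodable =
  odd λ { (_ ∷ _ ∷ Y) |Y|≡ → toSyms-∷∷ Y (undecodable Y (suc-injective (suc-injective |Y|≡))) }
  where
  toSyms-∷∷ : ∀ {a b} Y → toSyms Y ≡ nothing → toSyms (a ∷ b ∷ Y) ≡ nothing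
  toSyms-∷∷ Y none rewrite none = refl

decodeFields : {V : Set} → (Sym → Maybe V) → List (List Sym) → Maybe (Circuit V)
decodeFields val (w ∷ d ∷ fs) =
  mapM val w >>= λ ins →
  binVal d >>= λ o →
  parseGates fs >>= λ gs →
  if wellFormed (circuit ins o gs) then just (circuit ins o gs) else nothing
decodeFields val _ = nothing

decode-encode : ∀ {V : Set} (val : Sym → Maybe V) ss → decode val (encode ss) ≡ decodeFields val (splitH ss)
decode-encode val ss rewrite toSyms-encode ss with splitH ss
... | []         = refl
... | _ ∷ []     = refl
... | _ ∷ _ ∷ _  = refl

decode-nothing : ∀ {V : Set} (val : Sym → Maybe V) X → toSyms X ≡ nothing → decode val X ≡ nothing
decode-nothing val X none rewrite none = refl

starToZero : Sym → Sym
starToZero sS = s0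
starToZero s  = s

starAfterHash : List Sym → Bool
starAfterHash []        = false
starAfterHash (sH ∷ ss) = anyB isStar ss
starAfterHash (_  ∷ ss) = starAfterHash ss

consHead-map : ∀ (k : Sym → Sym) x L → consHead (k x) (map (map k) L) ≡ map (map k) (consHead x L)
consHead-map k x []      = refl
consHead-map k x (_ ∷ _) = refl

splitH-starToZero : ∀ ss → splitH (map starToZero ss) ≡ map (map starToZero) (splitH ss)
splitH-starToZero []        = refl
splitH-starToZero (sH ∷ ss) = cong ([] ∷_) (splitH-starToZero ss)
splitH-starToZero (s0 ∷ ss) = trans (cong (consHead s0) (splitH-starToZero ss)) (consHead-map starToZero s0 (splitH ss))
splitH-starToZero (s1 ∷ ss) = trans (cong (consHead s1) (splitH-starToZero ss)) (consHead-map starToZero s1 (splitH ss))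
splitH-starToZero (sS ∷ ss) = trans (cong (consHead s0) (splitH-starToZero ss)) (consHead-map starToZero sS (splitH ss))

consHead-stars : ∀ x L → anyB (anyB isStar) (consHead x L) ≡ isStar x ∨ anyB (anyB isStar) L
consHead-stars x []      = ∨-identityʳ _
consHead-stars x (f ∷ L) = ∨-assoc (isStar x) (anyB isStar f) _

splitH-stars : ∀ ss → anyB (anyB isStar) (splitH ss) ≡ anyB isStar ss
splitH-stars []        = refl
splitH-stars (sH ∷ ss) = splitH-stars ss
splitH-stars (s0 ∷ ss) = trans (consHead-stars s0 (splitH ss)) (splitH-stars ss)
splitH-stars (s1 ∷ ss) = trans (consHead-stars s1 (splitH ss)) (splitH-stars ss)
splitH-stars (sS ∷ ss) = consHead-stars sS (splitH ss)

drop1-consHead : ∀ x L → drop 1 (consHead x L) ≡ drop 1 L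
drop1-consHead x []      = refl
drop1-consHead x (_ ∷ _) = refl

starAfterHash-splitH : ∀ ss → starAfterHash ss ≡ anyB (anyB isStar) (drop 1 (splitH ss))
starAfterHash-splitH []        = refl
starAfterHash-splitH (sH ∷ ss) = sym (splitH-stars ss)
starAfterHash-splitH (s0 ∷ ss) =
  trans (starAfterHash-splitH ss) (cong (anyB (anyB isStar)) (sym (drop1-consHead s0 (splitH ss))))
starAfterHash-splitH (s1 ∷ ss) =
  trans (starAfterHash-splitH ss) (cong (anyB (anyB isStar)) (sym (drop1-consHead s1 (splitH ss))))
starAfterHash-splitH (sS ∷ ss) =
  trans (starAfterHash-splitH ss) (cong (anyB (anyB isStar)) (sym (drop1-consHead sS (splitH ss))))

binVal-star : ∀ xs → anyB isStar xs ≡ true → binVal xs ≡ nothing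
binVal-star (x ∷ xs) = binAcc-star 0 (x ∷ xs)
  where
  binAcc-star : ∀ acc xs → anyB isStar xs ≡ true → binAcc acc xs ≡ nothing
  binAcc-star acc (s0 ∷ xs) star = binAcc-star _ xs star
  binAcc-star acc (s1 ∷ xs) star = binAcc-star _ xs star
  binAcc-star acc (sH ∷ xs) _    = refl
  binAcc-star acc (sS ∷ xs) _    = refl

parseGates-star : ∀ fs → anyB (anyB isStar) fs ≡ true → parseGates fs ≡ nothing
parseGates-star (a ∷ []) _ = refl
parseGates-star (a ∷ b ∷ fs) stars with anyB isStar a in a★
... | true rewrite binVal-star a a★ = refl
... | false with binVal a
...   | nothing = refl
...   | just _ with anyB isStar b in b★
...     | true rewrite binVal-star b b★ = refl
...     | false with binVal b
...       | nothing = refl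
...       | just _ rewrite parseGates-star fs stars = refl

mapM-boolVal-star : ∀ w → anyB isStar w ≡ true → mapM boolVal w ≡ nothing
mapM-boolVal-star (s0 ∷ w) star rewrite mapM-boolVal-star w star = refl
mapM-boolVal-star (s1 ∷ w) star rewrite mapM-boolVal-star w star = refl
mapM-boolVal-star (sH ∷ w) _    = refl
mapM-boolVal-star (sS ∷ w) _    = refl

decodeFields-starAfterHash : ∀ {V : Set} (val : Sym → Maybe V) fields →
                             anyB (anyB isStar) (drop 1 fields) ≡ true → decodeFields val fields ≡ nothing
decodeFields-starAfterHash val (w ∷ d ∷ fs) stars with mapM val w | anyB isStar d in d★
... | nothing | _     = refl
... | just _  | true  rewrite binVal-star d d★ = refl
... | just _  | false with binVal d
...   | nothing = refl
...   | just _  rewrite parseGates-star fs stars = refl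

decodeFields-boolVal-star : ∀ fields → anyB (anyB isStar) fields ≡ true → decodeFields boolVal fields ≡ nothing
decodeFields-boolVal-star (w ∷ []) _ = refl
decodeFields-boolVal-star (w ∷ d ∷ fs) stars with anyB isStar w in w★
... | true  rewrite mapM-boolVal-star w w★ = refl
... | false = decodeFields-starAfterHash boolVal (w ∷ d ∷ fs) stars

mapM-map : ∀ {A B : Set} {valA : Sym → Maybe A} {valB : Sym → Maybe B} (h : A → B) (k : Sym → Sym) {w} →
           All (λ s → valB (k s) ≡ mmap h (valA s)) w → mapM valB (map k w) ≡ mmap (map h) (mapM valA w)
mapM-map h k [] = refl
mapM-map {valA = valA} {valB} h k {s ∷ w} (head ∷ tail)
  with valA s | valB (k s) | head | mapM valA w | mapM valB (map k w) | mapM-map {valA = valA} {valB} h k tail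
... | nothing | _ | refl | _       | _ | _    = refl
... | just _  | _ | refl | nothing | _ | refl = refl
... | just _  | _ | refl | just _  | _ | refl = refl

decodeFields-map : ∀ {A B : Set} {valA : Sym → Maybe A} {valB : Sym → Maybe B} (h : A → B) w′ w rest →
                   mapM valB w′ ≡ mmap (map h) (mapM valA w) →
                   decodeFields valB (w′ ∷ rest) ≡ mmap (mapCircuit h) (decodeFields valA (w ∷ rest))
decodeFields-map h w′ w [] _ = refl
decodeFields-map {valA = valA} h w′ w (d ∷ fs) inputs-map rewrite inputs-map
  with mapM valA w | binVal d | parseGates fs
... | nothing  | _       | _       = refl
... | just _   | nothing | _       = refl
... | just _   | just _  | nothing = refl
... | just ins | just o  | just gs rewrite length-map h ins with wellFormed (circuit ins o gs)
...   | true  = refl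
...   | false = refl

boolVal-starToZero : ∀ s → boolVal (starToZero s) ≡ mmap threshold (t3Val s)
boolVal-starToZero s0 = refl
boolVal-starToZero s1 = refl
boolVal-starToZero sH = refl
boolVal-starToZero sS = refl

t3Val-embed : ∀ s → isStar s ≡ false → t3Val s ≡ mmap embed (boolVal s)
t3Val-embed s0 _ = refl
t3Val-embed s1 _ = refl
t3Val-embed sH _ = refl

starToZero-fixes : ∀ s → isStar s ≡ false → starToZero s ≡ s
starToZero-fixes s0 _ = refl
starToZero-fixes s1 _ = refl
starToZero-fixes sH _ = refl

decodeFields-starToZero : ∀ fields → anyB (anyB isStar) (drop 1 fields) ≡ false →
                          decodeFields boolVal (map (map starToZero) fields)
                          ≡ mmap (mapCircuit threshold) (decodeFields t3Val fields)
decodeFields-starToZero []          _    = refl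
decodeFields-starToZero (w ∷ rest) free = begin
  decodeFields boolVal (map starToZero w ∷ map (map starToZero) rest)
    ≡⟨ cong (λ rest′ → decodeFields boolVal (map starToZero w ∷ rest′))
            (map-id-local (All.map fixes (anyB≡false⇒All rest free))) ⟩
  decodeFields boolVal (map starToZero w ∷ rest)
    ≡⟨ decodeFields-map threshold (map starToZero w) w rest
         (mapM-map threshold starToZero (All.universal boolVal-starToZero w)) ⟩
  mmap (mapCircuit threshold) (decodeFields t3Val (w ∷ rest)) ∎
  where
  fixes : ∀ {f} → anyB isStar f ≡ false → map starToZero f ≡ f
  fixes {f} free = map-id-local (All.map (starToZero-fixes _) (anyB≡false⇒All f free))

decodeFields-embed : ∀ fields → anyB (anyB isStar) fields ≡ false →
                     decodeFields t3Val fields ≡ mmap (mapCircuit embed) (decodeFields boolVal fields)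
decodeFields-embed []         _    = refl
decodeFields-embed (w ∷ rest) free = decodeFields-map embed w w rest inputs-embed
  where
  inputs-embed : mapM t3Val w ≡ mmap (map embed) (mapM boolVal w)
  inputs-embed = trans (cong (mapM t3Val) (sym (map-id w)))
                       (mapM-map embed id (All.map (t3Val-embed _) (anyB≡false⇒All w (∨-conicalˡ _ _ free))))

Sentence : Form → Set
Sentence ψ = ∀ X ρ σ → evalF X ρ ψ ≡ evalF X σ ψ

guarded : Form → Form → BitString → BitString
guarded reject φ X = if evalF X env₀ reject then [] else applyUpTo (λ i → evalF X (push i env₀) φ) (length X)

bitAt-applyUpTo : ∀ (f : ℕ → Bool) n i → i < n → bitAt (applyUpTo f n) i ≡ f i
bitAt-applyUpTo f (suc n) zero    _         = refl
bitAt-applyUpTo f (suc n) (suc i) (s≤s i<n) = bitAt-applyUpTo (f ∘ suc) n i i<n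

guarded-AC0 : ∀ reject φ → Sentence reject → AC0Function (guarded reject φ)
guarded-AC0 reject φ sentence = record
  { bound    = len
  ; lenForm  = ((one ⊕ var 0) ≤f len) ∧f ¬f reject
  ; bitForm  = φ
  ; bound-ok = bound-ok
  ; len-ok   = len-ok
  ; bit-ok   = bit-ok
  }
  where
  bound-ok : ∀ X → length (guarded reject φ X) ≤ length X
  bound-ok X with evalF X env₀ reject
  ... | true  = z≤n
  ... | false = ≤-reflexive (length-applyUpTo _ (length X))
  len-ok : ∀ X i → (suc i ≤ᵇ length X) ∧ not (evalF X (push i env₀) reject)
                   ≡ (i <ᵇ length (guarded reject φ X))
  len-ok X i rewrite sentence X (push i env₀) env₀ with evalF X env₀ reject
  ... | true  = ∧-zeroʳ _
  ... | false = trans (∧-identityʳ _) (cong (i <ᵇ_) (sym (length-applyUpTo _ (length X))))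
  bit-ok : ∀ X i → i < length (guarded reject φ X) → evalF X (push i env₀) φ ≡ bitAt (guarded reject φ X) i
  bit-ok X i with evalF X env₀ reject
  ... | false = λ i<n → sym (bitAt-applyUpTo _ (length X) i (subst (i <_) (length-applyUpTo _ (length X)) i<n))

guarded-decode : ∀ {A B : Set} {valA : Sym → Maybe A} {valB : Sym → Maybe B} (h : A → B) reject φ →
                 (∀ ss → decode valB (guarded reject φ (encode ss))
                         ≡ mmap (mapCircuit h) (decode valA (encode ss))) →
                 ∀ X → decode valB (guarded reject φ X) ≡ mmap (mapCircuit h) (decode valA X)
guarded-decode {valA = valA} {valB} h reject φ on-encoded X with parity X
... | encoded ss      = on-encoded ss
... | odd undecodable =
  trans output-undecodable (sym (cong (mmap (mapCircuit h)) (decode-nothing valA X (undecodable X refl))))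
  where
  output-undecodable : decode valB (guarded reject φ X) ≡ nothing
  output-undecodable with evalF X env₀ reject
  ... | true  = refl
  ... | false = decode-nothing valB bits (undecodable bits (length-applyUpTo _ (length X)))
    where
    bits : BitString
    bits = applyUpTo (λ i → evalF X (push i env₀) φ) (length X)

applyUpTo-bitAt : ∀ {f : ℕ → Bool} Y {n} → length Y ≡ n → (∀ i → f i ≡ bitAt Y i) → applyUpTo f n ≡ Y
applyUpTo-bitAt []      refl _    = refl
applyUpTo-bitAt (y ∷ Y) refl f≗Y = cong₂ _∷_ (f≗Y 0) (applyUpTo-bitAt Y refl (f≗Y ∘ suc))

starAt hashAt : Term → Form
starAt t = bit (t ⊕ t) ∧f bit (one ⊕ (t ⊕ t))
hashAt t = bit (t ⊕ t) ∧f ¬f (bit (one ⊕ (t ⊕ t)))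

someStarFm : Form
someStarFm = ∃≤ len (starAt (var 0))

starAfterHashFm : Form
starAfterHashFm = ∃≤ len (starAt (var 0) ∧f ∃≤ (var 0) (((one ⊕ var 0) ≤f var 1) ∧f hashAt (var 0)))

-- Bit i survives unless the pair ⌊ i /2⌋ containing it is '*'.
starToZeroBitFm : Form
starToZeroBitFm =
  bit (var 0) ∧f
  ¬f (∃≤ (var 0) ((((var 0 ⊕ var 0) ≡f var 1) ∨f ((one ⊕ (var 0 ⊕ var 0)) ≡f var 1)) ∧f starAt (var 0)))

someStar-encode : ∀ ss → evalF (encode ss) env₀ someStarFm ≡ anyB isStar ss
someStar-encode ss =
  trans (anyB-cong (encode-isStar ss) (upTo (suc (length (encode ss)))))
        (anyB-getAt-upTo isStar refl ss _ (m≤n⇒m≤1+n (length-encode ss)))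

hashBefore : List Sym → ℕ → Bool
hashBefore ss n = anyB (λ j → (suc j ≤ᵇ n) ∧ isHash (getAt s0 ss j)) (upTo (suc n))

starAfterHash-getAt : ∀ ss m → length ss ≤ m →
                      anyB (λ n → isStar (getAt s0 ss n) ∧ hashBefore ss n) (upTo m) ≡ starAfterHash ss
starAfterHash-getAt []       m       _         = anyB-false (λ _ → refl) (upTo m)
starAfterHash-getAt (s ∷ ss) (suc m) (s≤s |ss|≤m) = begin
  anyB (λ n → isStar (getAt s0 (s ∷ ss) n) ∧ hashBefore (s ∷ ss) n) (upTo (suc m))
    ≡⟨ anyB-upTo-suc (λ n → isStar (getAt s0 (s ∷ ss) n) ∧ hashBefore (s ∷ ss) n) m ⟩
  (isStar s ∧ false) ∨ anyB (λ n → isStar (getAt s0 ss n) ∧ hashBefore (s ∷ ss) (suc n)) (upTo m)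
    ≡⟨ cong₂ _∨_ (∧-zeroʳ (isStar s))
                 (anyB-cong (λ n → cong (isStar (getAt s0 ss n) ∧_) (hashBefore-suc n)) (upTo m)) ⟩
  anyB (λ n → isStar (getAt s0 ss n) ∧ (isHash s ∨ hashBefore ss n)) (upTo m)
    ≡⟨ after s ⟩
  starAfterHash (s ∷ ss) ∎
  where
  hashBefore-suc : ∀ n → hashBefore (s ∷ ss) (suc n) ≡ isHash s ∨ hashBefore ss n
  hashBefore-suc n = anyB-upTo-suc (λ j → (suc j ≤ᵇ suc n) ∧ isHash (getAt s0 (s ∷ ss) j)) (suc n)
  after : ∀ s → anyB (λ n → isStar (getAt s0 ss n) ∧ (isHash s ∨ hashBefore ss n)) (upTo m)
                ≡ starAfterHash (s ∷ ss)
  after sH = trans (anyB-cong (λ n → ∧-identityʳ _) (upTo m)) (anyB-getAt-upTo isStar refl ss m |ss|≤m)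
  after s0 = starAfterHash-getAt ss m |ss|≤m
  after s1 = starAfterHash-getAt ss m |ss|≤m
  after sS = starAfterHash-getAt ss m |ss|≤m

starAfterHash-encode : ∀ ss → evalF (encode ss) env₀ starAfterHashFm ≡ starAfterHash ss
starAfterHash-encode ss =
  trans (anyB-cong (λ n → cong₂ _∧_ (encode-isStar ss n) (hashBefore-encode n)) (upTo (suc (length (encode ss)))))
        (starAfterHash-getAt ss _ (m≤n⇒m≤1+n (length-encode ss)))
  where
  hashBefore-encode : ∀ n → evalF (encode ss) (push n env₀) (∃≤ (var 0) (((one ⊕ var 0) ≤f var 1) ∧f hashAt (var 0)))
                            ≡ hashBefore ss n
  hashBefore-encode n = anyB-cong (λ j → cong ((suc j ≤ᵇ n) ∧_) (encode-isHash ss j)) (upTo (suc n))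

pair-index : ∀ n i → ((n + n ≡ᵇ i) ∨ (suc (n + n) ≡ᵇ i)) ≡ (n ≡ᵇ ⌊ i /2⌋)
pair-index zero    zero          = refl
pair-index zero    (suc zero)    = refl
pair-index zero    (suc (suc i)) = refl
pair-index (suc n) zero          = refl
pair-index (suc n) (suc i) rewrite +-suc n n with i
... | zero   = refl
... | suc i′ = pair-index n i′

starToZero-bits : ∀ s → hi (starToZero s) ≡ hi s ∧ not (isStar s) × lo (starToZero s) ≡ lo s ∧ not (isStar s)
starToZero-bits s0 = refl , refl
starToZero-bits s1 = refl , refl
starToZero-bits sH = refl , refl
starToZero-bits sS = refl , refl

encode-starToZero : ∀ ss i →
                    bitAt (encode (map starToZero ss)) i ≡ bitAt (encode ss) i ∧ not (isStar (getAt s0 ss ⌊ i /2⌋))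
encode-starToZero []       i             = refl
encode-starToZero (s ∷ ss) zero          = proj₁ (starToZero-bits s)
encode-starToZero (s ∷ ss) (suc zero)    = proj₂ (starToZero-bits s)
encode-starToZero (s ∷ ss) (suc (suc i)) = encode-starToZero ss i

starToZeroBit-encode : ∀ ss i →
                       evalF (encode ss) (push i env₀) starToZeroBitFm ≡ bitAt (encode (map starToZero ss)) i
starToZeroBit-encode ss i = begin
  evalF (encode ss) (push i env₀) starToZeroBitFm
    ≡⟨ cong (λ b → bitAt (encode ss) i ∧ not b)
            (anyB-cong (λ n → cong₂ _∧_ (pair-index n i) (encode-isStar ss n)) (upTo (suc i))) ⟩
  bitAt (encode ss) i ∧ not (anyB (λ n → (n ≡ᵇ ⌊ i /2⌋) ∧ isStar (getAt s0 ss n)) (upTo (suc i)))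
    ≡⟨ cong (λ b → bitAt (encode ss) i ∧ not b)
            (anyB-≡ᵇ-upTo (isStar ∘ getAt s0 ss) ⌊ i /2⌋ (suc i) (s≤s (⌊n/2⌋≤n i))) ⟩
  bitAt (encode ss) i ∧ not (isStar (getAt s0 ss ⌊ i /2⌋))
    ≡⟨ sym (encode-starToZero ss i) ⟩
  bitAt (encode (map starToZero ss)) i ∎

threeValued→bool : BitString → BitString
threeValued→bool = guarded starAfterHashFm starToZeroBitFm

bool→threeValued : BitString → BitString
bool→threeValued = guarded someStarFm (bit (var 0))

threeValued→bool-encode : ∀ ss → decode boolVal (threeValued→bool (encode ss))
                                  ≡ mmap (mapCircuit threshold) (decode t3Val (encode ss))
threeValued→bool-encode ss rewrite decode-encode t3Val ss | starAfterHash-encode ss with starAfterHash ss in bad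
... | true  = sym (cong (mmap (mapCircuit threshold))
                        (decodeFields-starAfterHash t3Val (splitH ss) (trans (sym (starAfterHash-splitH ss)) bad)))
... | false = begin
  decode boolVal (applyUpTo (λ i → evalF (encode ss) (push i env₀) starToZeroBitFm) (length (encode ss)))
    ≡⟨ cong (decode boolVal)
            (applyUpTo-bitAt (encode (map starToZero ss)) (length-encode-map starToZero ss) (starToZeroBit-encode ss)) ⟩
  decode boolVal (encode (map starToZero ss))
    ≡⟨ decode-encode boolVal (map starToZero ss) ⟩
  decodeFields boolVal (splitH (map starToZero ss))
    ≡⟨ cong (decodeFields boolVal) (splitH-starToZero ss) ⟩
  decodeFields boolVal (map (map starToZero) (splitH ss))
    ≡⟨ decodeFields-starToZero (splitH ss) (trans (sym (starAfterHash-splitH ss)) bad) ⟩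
  mmap (mapCircuit threshold) (decodeFields t3Val (splitH ss)) ∎

bool→threeValued-encode : ∀ ss → decode t3Val (bool→threeValued (encode ss))
                                  ≡ mmap (mapCircuit embed) (decode boolVal (encode ss))
bool→threeValued-encode ss rewrite decode-encode boolVal ss | someStar-encode ss with anyB isStar ss in stars
... | true  = sym (cong (mmap (mapCircuit embed))
                        (decodeFields-boolVal-star (splitH ss) (trans (splitH-stars ss) stars)))
... | false = begin
  decode t3Val (applyUpTo (bitAt (encode ss)) (length (encode ss)))
    ≡⟨ cong (decode t3Val) (applyUpTo-bitAt (encode ss) refl (λ _ → refl)) ⟩
  decode t3Val (encode ss)
    ≡⟨ decode-encode t3Val ss ⟩
  decodeFields t3Val (splitH ss)
    ≡⟨ decodeFields-embed (splitH ss) (trans (splitH-stars ss) stars) ⟩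
  mmap (mapCircuit embed) (decodeFields boolVal (splitH ss)) ∎

threeValued→bool-decode : ∀ X → decode boolVal (threeValued→bool X) ≡ mmap (mapCircuit threshold) (decode t3Val X)
threeValued→bool-decode = guarded-decode threshold starAfterHashFm starToZeroBitFm threeValued→bool-encode

bool→threeValued-decode : ∀ X → decode t3Val (bool→threeValued X) ≡ mmap (mapCircuit embed) (decode boolVal X)
bool→threeValued-decode = guarded-decode embed someStarFm (bit (var 0)) bool→threeValued-encode

theorem35 : (ThreeValuedCCV ≤AC0 CCV) × (CCV ≤AC0 ThreeValuedCCV)
theorem35 =
  homomorphism⇒≤AC0 threshold (evalCircuit-map threshold refl threshold-⊓₃ threshold-⊔₃) threshold≡true⇔
    threeValued→bool (guarded-AC0 starAfterHashFm starToZeroBitFm (λ _ _ _ → refl)) threeValued→bool-decode ,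
  homomorphism⇒≤AC0 embed (evalCircuit-map embed refl embed-∧ embed-∨) embed≡t1⇔
    bool→threeValued (guarded-AC0 someStarFm (bit (var 0)) (λ _ _ _ → refl)) bool→threeValued-decode
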